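{- Let $D$ be a database and $\Pi$ a DatalogMTL program that only uses temporal operators of the form $\Diamond^-_{[0,t_2\rangle}$. Then there exists a time point $T\in\mathbb Q$ such that for every $t>T$ and every ground atom $\alpha$: $\alpha@t\in\Pi(D)$ iff $\alpha@T\in\Pi(D)$.
   Context: DatalogMTL over $\mathbb Q$ with continuous semantics. The program consists of rules of the forms $P_1(\boldsymbol\tau_1)\land\dots\land P_n(\boldsymbol\tau_n)\to P_0(\boldsymbol\tau_0)$ ($n\ge0$) and $\Diamond^-_{[0,t_2\rangle}P_1(\boldsymbol\tau_1)\to P_0(\boldsymbol\tau_0)$, where $[0,t_2\rangle$ is an interval with left endpoint $0$ closed and right end $t_2$ open or closed, and $\mathfrak M,t\models\Diamond^-_\varrho A$ iff $\mathfrak M,s\models A$ for some $s$ with $t-s\in\varrho$. A database is a finite set of facts $A@\varrho$ ($A$ ground atom, $\varrho$ an interval). $\Pi(D)$ is the minimum model of $\Pi$ and $D$; $\alpha@t\in\Pi(D)$ means $\alpha$ holds at $t$ in it. -}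

module Defs where

open import Level using (0ℓ)
open import Data.Nat using (ℕ)
open import Data.Rational using (ℚ; 0ℚ; _≤_; _<_; _-_)
open import Data.List using (List; map)
open import Data.List.Membership.Propositional using (_∈_)
open import Data.List.Relation.Unary.All using (All)
open import Data.List.Relation.Unary.Any using (Any)
open import Data.Product using (Σ; _×_; ∃)
open import Data.Unit using (⊤)
open import Relation.Binary.PropositionalEquality using (_≡_)

data Term : Set where
  var   : ℕ → Term
  const : ℕ → Term

record Atom : Set where
  constructor atom
  field
    pred : ℕ
    args : List Term

record GAtom : Set where
  constructor gatom
  field
    gpred : ℕ
    gargs : List ℕ

Subst : Set
Subst = ℕ → ℕ

termVal : Subst → Term → ℕ
termVal σ (var x)   = σ x
termVal σ (const c) = c

ground : Subst → Atom → GAtom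
ground σ (atom p ts) = gatom p (map (termVal σ) ts)

data LBound : Set where
  -∞   : LBound
  lcl  : ℚ → LBound
  lop  : ℚ → LBound

data UBound : Set where
  +∞   : UBound
  ucl  : ℚ → UBound
  uop  : ℚ → UBound

record Interval : Set where
  constructor ⟨_,_⟩
  field
    lower : LBound
    upper : UBound

aboveL : LBound → ℚ → Set
aboveL -∞      t = ⊤
aboveL (lcl q) t = q ≤ t
aboveL (lop q) t = q < t

belowU : UBound → ℚ → Set
belowU +∞      t = ⊤
belowU (ucl q) t = t ≤ q
belowU (uop q) t = t < q

_∈I_ : ℚ → Interval → Set
t ∈I ⟨ l , u ⟩ = aboveL l t × belowU u t

-- Rules and programs.
--   plain  [P₁(τ₁),…,Pₙ(τₙ)] P₀(τ₀)   :  P₁(τ₁) ∧ … ∧ Pₙ(τₙ) → P₀(τ₀)   (n ≥ 0)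
--   diamond u P₁(τ₁) P₀(τ₀)           :  ◇⁻_{[0,t₂⟩} P₁(τ₁) → P₀(τ₀)
--       where u encodes the right end  t₂⟩  of [0,t₂⟩ (closed, open, or ∞)

data Rule : Set where
  plain   : List Atom → Atom → Rule
  diamond : UBound → Atom → Atom → Rule

Program : Set
Program = List Rule

record Fact : Set where
  constructor _at_
  field
    fatom : GAtom
    fint  : Interval

Database : Set
Database = List Fact

varsOf : Atom → List ℕ
varsOf (atom p ts) = collect ts
  where
  collect : List Term → List ℕ
  collect List.[]              = List.[]
  collect (var x List.∷ ts)    = x List.∷ collect ts
  collect (const _ List.∷ ts)  = collect ts

SafeRule : Rule → Set
SafeRule (plain body h)     = ∀ {x} → x ∈ varsOf h → Any (λ b → x ∈ varsOf b) body
SafeRule (diamond _ b h)    = ∀ {x} → x ∈ varsOf h → x ∈ varsOf b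

SafeProgram : Program → Set
SafeProgram Π = All SafeRule Π

Interp : Set₁
Interp = GAtom → ℚ → Set

Diamond⁻ : Interp → UBound → GAtom → ℚ → Set
Diamond⁻ M u α t = ∃ λ s → (0ℚ ≤ t - s) × belowU u (t - s) × M α s

SatRule : Interp → Rule → Set
SatRule M (plain body h)   =
  ∀ (σ : Subst) (t : ℚ) → All (λ b → M (ground σ b) t) body → M (ground σ h) t
SatRule M (diamond u b h)  =
  ∀ (σ : Subst) (t : ℚ) → Diamond⁻ M u (ground σ b) t → M (ground σ h) t

SatFact : Interp → Fact → Set
SatFact M (α at ϱ) = ∀ t → t ∈I ϱ → M α t

IsModel : Program → Database → Interp → Set
IsModel Π D M = All (SatRule M) Π × All (SatFact M) D

-- α@t ∈ Π(D): α holds at t in the minimum model of Π and D, i.e. in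
-- every model of Π and D (the minimum model is the intersection of all models).
_holdsAt_∈⟦_,_⟧ : GAtom → ℚ → Program → Database → Set₁
α holdsAt t ∈⟦ Π , D ⟧ = ∀ (M : Interp) → IsModel Π D M → M α t

module Submission where

open import Defs
open import Data.Rational using (ℚ; _<_)
open import Data.Product using (Σ)
open import Function.Bundles using (_⇔_)

open import Data.Rational using (0ℚ; 1ℚ; _≤_; _+_; _-_; -_; _⊔_; mkℚ; *≤*)
open import Data.Rational.Literals using (fromℤ)
open import Data.Rational.Properties
  using ( ≤-refl; ≤-reflexive; ≤-trans; <⇒≤; <-≤-trans; ≤-decTotalOrder; _≤?_; ≰⇒>
        ; +-identityʳ; +-inverseʳ; +-monoˡ-≤; +-monoʳ-≤; +-monoʳ-<; neg-antimono-≤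
        ; positive⁻¹; ≤-<-trans; <-irrefl; p≤p⊔q; p≤q⊔p; toℚᵘ-injective; toℚᵘ-homo-+; module ≤-Reasoning )
open import Data.Rational.Solver using (module +-*-Solver)
import Data.Rational.Unnormalised as ℚᵘ
import Data.Rational.Unnormalised.Properties as ℚᵘ
open import Data.Nat using (ℕ; zero; suc; s≤s; z≤n)
open import Data.Integer as ℤ using (ℤ; +_; -[1+_]; +≤+; -≤+)
open import Data.Integer.Properties using (*-monoˡ-≤-nonNeg)
open import Data.Integer.Tactic.RingSolver using (solve-∀)
open import Data.List using (List; []; _∷_; [_]; map; _++_; concatMap; length; cartesianProductWith)
open import Data.List.Properties using (length-map; length-removeAt′)
open import Relation.Binary.Bundles using (DecTotalOrder)
open import Data.List.Extrema (DecTotalOrder.totalOrder ≤-decTotalOrder) using (max; ⊥≤max; xs≤max)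
open import Data.List.Membership.Propositional using (_∈_; _─_; lose)
open import Data.List.Membership.Propositional.Properties
  using (∈-map⁺; ∈-++⁺ˡ; ∈-++⁺ʳ; ∈-concatMap⁺; ∈-cartesianProductWith⁺)
open import Data.List.Relation.Unary.All as All using (All; []; _∷_)
open import Data.List.Relation.Unary.Any using (Any; here; there; index)
open import Data.Product using (_,_)
open import Data.Sum using (_⊎_; inj₁; inj₂)
import Data.Sum as Sum
open import Data.Unit using (tt)
open import Data.Empty using (⊥-elim)
open import Function using (_∘_)
open import Relation.Nullary using (yes; no)
open import Relation.Binary.PropositionalEquality using (_≡_; refl; sym; cong; subst)
open import Function.Bundles using (mk⇔)

-- Above the largest finite endpoint E of the database every fact interval is
-- unbounded above, and every diamond window contains 0; hence above E the set of
-- times at which an atom is derivable is downward closed.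
--
-- For the converse we shift a derivation of α@t forward by y.  Let L bound the
-- finite diamond windows and split the time line above E into windows of length
-- L + 1, one per atom that can be derived at all.  Shifting the nodes of a derivation is harmless
-- except at a diamond premise γ@s that drops below the current window.  Either γ
-- is already known to hold at the top of the window, and γ@(s + y) is then
-- obtained from that occurrence by a shift at least 1 shorter; or γ is met for
-- the first time, and we continue one window lower with γ recorded as known.
-- With N possible atoms, N + 1 windows above E always suffice.

module _ where
  open +-*-Solver

  p+[q-p]≡q : ∀ p q → p + (q - p) ≡ q
  p+[q-p]≡q = solve 2 (λ p q → p :+ (q :- p) := q) refl

  [p+r]-[q+r]≡p-q : ∀ p q r → (p + r) - (q + r) ≡ p - q
  [p+r]-[q+r]≡p-q = solve 3 (λ p q r → (p :+ r) :- (q :+ r) := p :- q) refl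

  [p+r]-q≡[p-q]+r : ∀ p q r → (p + r) - q ≡ (p - q) + r
  [p+r]-q≡[p-q]+r = solve 3 (λ p q r → (p :+ r) :- q := (p :- q) :+ r) refl

  p-[p-q]≡q : ∀ p q → p - (p - q) ≡ q
  p-[p-q]≡q = solve 2 (λ p q → p :- (p :- q) := q) refl

  [p+q]-q≡p : ∀ p q → (p + q) - q ≡ p
  [p+q]-q≡p = solve 2 (λ p q → (p :+ q) :- q := p) refl

  [p+q]-[p+1]≡q-1 : ∀ p q → (p + q) - (p + 1ℚ) ≡ q - 1ℚ
  [p+q]-[p+1]≡q-1 = solve 2 (λ p q → (p :+ q) :- (p :+ con 1ℚ) := q :- con 1ℚ) refl

  [1+p]-1≡p : ∀ p → (1ℚ + p) - 1ℚ ≡ p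
  [1+p]-1≡p = solve 1 (λ p → (con 1ℚ :+ p) :- con 1ℚ := p) refl

open ≤-Reasoning

p≤p+q : ∀ p {q} → 0ℚ ≤ q → p ≤ p + q
p≤p+q p {q} 0≤q = begin
  p       ≡⟨ sym (+-identityʳ p) ⟩
  p + 0ℚ  ≤⟨ +-monoʳ-≤ p 0≤q ⟩
  p + q   ∎

0≤1 : 0ℚ ≤ 1ℚ
0≤1 = <⇒≤ (positive⁻¹ 1ℚ)

p<p+1 : ∀ p → p < p + 1ℚ
p<p+1 p = begin-strict
  p       ≡⟨ sym (+-identityʳ p) ⟩
  p + 0ℚ  <⟨ +-monoʳ-< p (positive⁻¹ 1ℚ) ⟩
  p + 1ℚ  ∎

p≤q⇒0≤q-p : ∀ {p q} → p ≤ q → 0ℚ ≤ q - p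
p≤q⇒0≤q-p {p} {q} p≤q = begin
  0ℚ     ≡⟨ sym (+-inverseʳ p) ⟩
  p - p  ≤⟨ +-monoˡ-≤ (- p) p≤q ⟩
  q - p  ∎

p+r≤t⇒t-s≤r⇒p≤s : ∀ {p r s t} → p + r ≤ t → t - s ≤ r → p ≤ s
p+r≤t⇒t-s≤r⇒p≤s {p} {r} {s} {t} p+r≤t t-s≤r = begin
  p            ≡⟨ sym ([p+q]-q≡p p r) ⟩
  (p + r) - r  ≤⟨ +-monoˡ-≤ (- r) p+r≤t ⟩
  t - r        ≤⟨ +-monoʳ-≤ t (neg-antimono-≤ t-s≤r) ⟩
  t - (t - s)  ≡⟨ p-[p-q]≡q t s ⟩
  s            ∎

s≤p⇒[s+y]-[p+1]≤k : ∀ {s p y k} → s ≤ p → y ≤ 1ℚ + k → (s + y) - (p + 1ℚ) ≤ k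
s≤p⇒[s+y]-[p+1]≤k {s} {p} {y} {k} s≤p y≤1+k = begin
  (s + y) - (p + 1ℚ)  ≤⟨ +-monoʳ-≤ (s + y) (neg-antimono-≤ (+-monoˡ-≤ 1ℚ s≤p)) ⟩
  (s + y) - (s + 1ℚ)  ≡⟨ [p+q]-[p+1]≡q-1 s y ⟩
  y - 1ℚ              ≤⟨ +-monoˡ-≤ (- 1ℚ) y≤1+k ⟩
  (1ℚ + k) - 1ℚ       ≡⟨ [1+p]-1≡p k ⟩
  k                   ∎

fromℕ : ℕ → ℚ
fromℕ n = fromℤ (+ n)

fromℕ-suc : ∀ n → fromℕ (suc n) ≡ 1ℚ + fromℕ n
fromℕ-suc n =
  toℚᵘ-injective (ℚᵘ.≃-trans (ℚᵘ.*≡* (cross-multiplied (+ n))) (ℚᵘ.≃-sym (toℚᵘ-homo-+ 1ℚ (fromℕ n))))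
  where
  cross-multiplied : ∀ (x : ℤ) → (+ 1 ℤ.+ x) ℤ.* + 1 ≡ (+ 1 ℤ.* + 1 ℤ.+ x ℤ.* + 1) ℤ.* + 1
  cross-multiplied = solve-∀

archimedean : ∀ p → Σ ℕ λ n → p ≤ fromℕ n
archimedean (mkℚ (+ m) d _)    = m , *≤* (*-monoˡ-≤-nonNeg (+ m) (+≤+ (s≤s z≤n)))
archimedean (mkℚ -[1+ m ] _ _) = 0 , *≤* -≤+

∈-─⁻ : ∀ {A : Set} {x y : A} {xs} (y∈xs : y ∈ xs) → x ∈ xs → x ≡ y ⊎ x ∈ xs ─ y∈xs
∈-─⁻ (here refl)  (here refl) = inj₁ refl
∈-─⁻ (here refl)  (there x∈)  = inj₂ x∈
∈-─⁻ (there y∈)   (here refl) = inj₂ (here refl)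
∈-─⁻ (there y∈)   (there x∈)  = Sum.map₂ there (∈-─⁻ y∈ x∈)

tuples : List ℕ → ℕ → List (List ℕ)
tuples C zero    = [ [] ]
tuples C (suc n) = cartesianProductWith _∷_ C (tuples C n)

∈-tuples : ∀ {C xs} → All (_∈ C) xs → xs ∈ tuples C (length xs)
∈-tuples []           = here refl
∈-tuples (x∈C ∷ xs∈C) = ∈-cartesianProductWith⁺ _∷_ x∈C (∈-tuples xs∈C)

-- Infinite endpoints are given the junk value 0.
lowerEnd : LBound → ℚ
lowerEnd -∞      = 0ℚ
lowerEnd (lcl q) = q
lowerEnd (lop q) = q

upperEnd : UBound → ℚ
upperEnd +∞      = 0ℚ
upperEnd (ucl q) = q
upperEnd (uop q) = q

belowU-mono : ∀ u {x z} → z ≤ x → belowU u x → belowU u z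
belowU-mono +∞      z≤x _   = tt
belowU-mono (ucl q) z≤x x≤q = ≤-trans z≤x x≤q
belowU-mono (uop q) z≤x x<q = ≤-<-trans z≤x x<q

belowU-finite : ∀ {u x} → belowU u x → u ≡ +∞ ⊎ x ≤ upperEnd u
belowU-finite {+∞}    _   = inj₁ refl
belowU-finite {ucl q} x≤q = inj₂ x≤q
belowU-finite {uop q} x<q = inj₂ (<⇒≤ x<q)

aboveL-beyond : ∀ l {e t} → lowerEnd l ≤ e → e < t → aboveL l t
aboveL-beyond -∞      _   _   = tt
aboveL-beyond (lcl q) q≤e e<t = <⇒≤ (≤-<-trans q≤e e<t)
aboveL-beyond (lop q) q≤e e<t = ≤-<-trans q≤e e<t

-- A finite right end at most e excludes every t > e, so the premise is then absurd.
belowU-beyond : ∀ u {e t t′} → upperEnd u ≤ e → e < t → belowU u t → belowU u t′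
belowU-beyond +∞      _   _   _   = tt
belowU-beyond (ucl q) q≤e e<t t≤q = ⊥-elim (<-irrefl refl (<-≤-trans e<t (≤-trans t≤q q≤e)))
belowU-beyond (uop q) q≤e e<t t<q = ⊥-elim (<-irrefl refl (<-≤-trans e<t (≤-trans (<⇒≤ t<q) q≤e)))

ends : Interval → ℚ
ends ⟨ l , u ⟩ = lowerEnd l ⊔ upperEnd u

∈I-beyond : ∀ ϱ {e t t′} → ends ϱ ≤ e → e < t → e < t′ → t ∈I ϱ → t′ ∈I ϱ
∈I-beyond ⟨ l , u ⟩ ends≤e e<t e<t′ (_ , below) =
  aboveL-beyond l (≤-trans (p≤p⊔q _ _) ends≤e) e<t′ ,
  belowU-beyond u (≤-trans (p≤q⊔p (lowerEnd l) _) ends≤e) e<t below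

module Derivations (Π : Program) (D : Database) where

  data Deriv : GAtom → ℚ → Set where
    by-fact    : ∀ {α ϱ t} → (α at ϱ) ∈ D → t ∈I ϱ → Deriv α t
    by-plain   : ∀ {body h t} (σ : Subst) → plain body h ∈ Π →
                 All (λ b → Deriv (ground σ b) t) body → Deriv (ground σ h) t
    by-diamond : ∀ {u b h t} (σ : Subst) → diamond u b h ∈ Π →
                 Diamond⁻ Deriv u (ground σ b) t → Deriv (ground σ h) t

  Deriv-isModel : IsModel Π D Deriv
  Deriv-isModel = All.tabulate rule , All.tabulate fact
    where
    rule : ∀ {r} → r ∈ Π → SatRule Deriv r
    rule {plain _ _}     r∈ σ t = by-plain σ r∈
    rule {diamond _ _ _} r∈ σ t = by-diamond σ r∈
    fact : ∀ {f} → f ∈ D → SatFact Deriv f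
    fact {_ at _} f∈ t = by-fact f∈

  mutual
    Deriv-sound : ∀ {α t} → Deriv α t → α holdsAt t ∈⟦ Π , D ⟧
    Deriv-sound (by-fact f∈ t∈) M (_ , facts) = All.lookup facts f∈ _ t∈
    Deriv-sound (by-plain σ r∈ ds) M M⊨@(rules , _) = All.lookup rules r∈ σ _ (Deriv-soundAll ds M M⊨)
    Deriv-sound (by-diamond σ r∈ (s , 0≤t-s , t-s∈ , d)) M M⊨@(rules , _) =
      All.lookup rules r∈ σ _ (s , 0≤t-s , t-s∈ , Deriv-sound d M M⊨)

    Deriv-soundAll : ∀ {body σ t} → All (λ b → Deriv (ground σ b) t) body →
                     ∀ M → IsModel Π D M → All (λ b → M (ground σ b) t) body
    Deriv-soundAll []       M M⊨ = []
    Deriv-soundAll (d ∷ ds) M M⊨ = Deriv-sound d M M⊨ ∷ Deriv-soundAll ds M M⊨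

  Deriv-complete : ∀ {α t} → α holdsAt t ∈⟦ Π , D ⟧ → Deriv α t
  Deriv-complete holds = holds Deriv Deriv-isModel

  E : ℚ
  E = max 0ℚ (map (ends ∘ Fact.fint) D)

  fact-beyond : ∀ {α ϱ t t′} → (α at ϱ) ∈ D → E < t → E < t′ → t ∈I ϱ → t′ ∈I ϱ
  fact-beyond {ϱ = ϱ} f∈ =
    ∈I-beyond ϱ (All.lookup (xs≤max 0ℚ (map (ends ∘ Fact.fint) D)) (∈-map⁺ (ends ∘ Fact.fint) f∈))

  mutual
    -- A premise later than t′ is moved to t′ itself, where the window contains 0.
    Deriv-down : ∀ {α t t′} → E < t′ → t′ ≤ t → Deriv α t → Deriv α t′
    Deriv-down E<t′ t′≤t (by-fact f∈ t∈) =
      by-fact f∈ (fact-beyond f∈ (<-≤-trans E<t′ t′≤t) E<t′ t∈)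
    Deriv-down E<t′ t′≤t (by-plain σ r∈ ds) = by-plain σ r∈ (Deriv-downAll E<t′ t′≤t ds)
    Deriv-down {t′ = t′} E<t′ t′≤t (by-diamond {u = u} σ r∈ (s , 0≤t-s , t-s∈ , d)) with s ≤? t′
    ... | yes s≤t′ =
      by-diamond σ r∈ (s , p≤q⇒0≤q-p s≤t′ , belowU-mono u (+-monoˡ-≤ (- s) t′≤t) t-s∈ , d)
    ... | no s≰t′ =
      by-diamond σ r∈ (t′ , ≤-reflexive (sym t′-t′≡0) ,
                       belowU-mono u (≤-trans (≤-reflexive t′-t′≡0) 0≤t-s) t-s∈ ,
                       Deriv-down E<t′ (<⇒≤ (≰⇒> s≰t′)) d)
      where t′-t′≡0 = +-inverseʳ t′

    Deriv-downAll : ∀ {body σ t t′} → E < t′ → t′ ≤ t →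
                    All (λ b → Deriv (ground σ b) t) body → All (λ b → Deriv (ground σ b) t′) body
    Deriv-downAll E<t′ t′≤t []       = []
    Deriv-downAll E<t′ t′≤t (d ∷ ds) = Deriv-down E<t′ t′≤t d ∷ Deriv-downAll E<t′ t′≤t ds

headOf : Rule → Atom
headOf (plain _ h)     = h
headOf (diamond _ _ h) = h

constants : List Term → List ℕ
constants []             = []
constants (var _ ∷ ts)   = constants ts
constants (const c ∷ ts) = c ∷ constants ts

var∈ground : ∀ σ p ts {x} → x ∈ varsOf (atom p ts) → σ x ∈ map (termVal σ) ts
var∈ground σ p (var y ∷ ts)   (here refl) = here refl
var∈ground σ p (var y ∷ ts)   (there x∈)  = there (var∈ground σ p ts x∈)
var∈ground σ p (const c ∷ ts) x∈          = there (var∈ground σ p ts x∈)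

All-termVal∈ : ∀ {C} σ p ts → (∀ {c} → c ∈ constants ts → c ∈ C) →
                (∀ {x} → x ∈ varsOf (atom p ts) → σ x ∈ C) → All (_∈ C) (map (termVal σ) ts)
All-termVal∈ σ p []             consts vars = []
All-termVal∈ σ p (var x ∷ ts)   consts vars = vars (here refl) ∷ All-termVal∈ σ p ts consts (vars ∘ there)
All-termVal∈ σ p (const c ∷ ts) consts vars = consts (here refl) ∷ All-termVal∈ σ p ts (consts ∘ there) vars

module Universe (Π : Program) (D : Database) (safe : SafeProgram Π) where

  open Derivations Π D

  C : List ℕ
  C = concatMap (GAtom.gargs ∘ Fact.fatom) D ++ concatMap (constants ∘ Atom.args ∘ headOf) Π

  groundings : Atom → List GAtom
  groundings (atom p ts) = map (gatom p) (tuples C (length ts))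

  Univ : List GAtom
  Univ = map Fact.fatom D ++ concatMap (groundings ∘ headOf) Π

  ArgsIn-C : GAtom → Set
  ArgsIn-C α = All (_∈ C) (GAtom.gargs α)

  headConst∈C : ∀ {r c} → r ∈ Π → c ∈ constants (Atom.args (headOf r)) → c ∈ C
  headConst∈C r∈ c∈ = ∈-++⁺ʳ _ (∈-concatMap⁺ (constants ∘ Atom.args ∘ headOf) (lose r∈ c∈))

  bodyVar∈C : ∀ σ b {x} → x ∈ varsOf b → ArgsIn-C (ground σ b) → σ x ∈ C
  bodyVar∈C σ (atom p ts) x∈ args = All.lookup args (var∈ground σ p ts x∈)

  mutual
    Deriv-args : ∀ {α t} → Deriv α t → ArgsIn-C α
    Deriv-args (by-fact f∈ _) =
      All.tabulate (λ c∈ → ∈-++⁺ˡ (∈-concatMap⁺ (GAtom.gargs ∘ Fact.fatom) (lose f∈ c∈)))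
    Deriv-args (by-plain {body} {atom p ts} σ r∈ ds) =
      All-termVal∈ σ p ts (headConst∈C r∈) (λ x∈ → viaBody (All.lookup safe r∈ x∈) (Deriv-argsAll ds))
      where
      viaBody : ∀ {bs x} → Any (λ b → x ∈ varsOf b) bs → All (λ b → ArgsIn-C (ground σ b)) bs → σ x ∈ C
      viaBody {b ∷ _} (here x∈) (args ∷ _) = bodyVar∈C σ b x∈ args
      viaBody (there x∈) (_ ∷ argss) = viaBody x∈ argss
    Deriv-args (by-diamond {b = b} {h = atom p ts} σ r∈ (_ , _ , _ , d)) =
      All-termVal∈ σ p ts (headConst∈C r∈) (λ x∈ → bodyVar∈C σ b (All.lookup safe r∈ x∈) (Deriv-args d))

    Deriv-argsAll : ∀ {body σ t} → All (λ b → Deriv (ground σ b) t) body →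
                    All (λ b → ArgsIn-C (ground σ b)) body
    Deriv-argsAll []       = []
    Deriv-argsAll (d ∷ ds) = Deriv-args d ∷ Deriv-argsAll ds

  ground∈groundings : ∀ σ a → ArgsIn-C (ground σ a) → ground σ a ∈ groundings a
  ground∈groundings σ (atom p ts) args =
    ∈-map⁺ (gatom p) (subst (λ n → map (termVal σ) ts ∈ tuples C n) (length-map (termVal σ) ts) (∈-tuples args))

  head∈Univ : ∀ {r σ} → r ∈ Π → ArgsIn-C (ground σ (headOf r)) → ground σ (headOf r) ∈ Univ
  head∈Univ {r} {σ} r∈ args =
    ∈-++⁺ʳ _ (∈-concatMap⁺ (groundings ∘ headOf) (lose r∈ (ground∈groundings σ (headOf r) args)))

  Deriv⇒∈Univ : ∀ {α t} → Deriv α t → α ∈ Univ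
  Deriv⇒∈Univ (by-fact f∈ _)          = ∈-++⁺ˡ (∈-map⁺ Fact.fatom f∈)
  Deriv⇒∈Univ d@(by-plain σ r∈ _)     = head∈Univ r∈ (Deriv-args d)
  Deriv⇒∈Univ d@(by-diamond σ r∈ _)   = head∈Univ r∈ (Deriv-args d)

reach : Rule → ℚ
reach (plain _ _)     = 0ℚ
reach (diamond u _ _) = upperEnd u

module Shifting (Π : Program) (D : Database) (safe : SafeProgram Π) where

  open Derivations Π D
  open Universe Π D safe

  L : ℚ
  L = max 0ℚ (map reach Π)

  reach≤L : ∀ {r} → r ∈ Π → reach r ≤ L
  reach≤L r∈ = All.lookup (xs≤max 0ℚ (map reach Π)) (∈-map⁺ reach r∈)

  -- level r is the bottom of the (r+1)-st window above E; derivations are shifted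
  -- from times ≥ level r + L, whose premises lie at times ≥ level r.
  level : ℕ → ℚ
  level zero    = E + 1ℚ
  level (suc r) = (level r + L) + 1ℚ

  level≤level+L : ∀ r → level r ≤ level r + L
  level≤level+L r = p≤p+q (level r) (⊥≤max 0ℚ (map reach Π))

  level+L≤level-suc : ∀ r → level r + L ≤ level (suc r)
  level+L≤level-suc r = p≤p+q (level r + L) 0≤1

  level≤level-suc : ∀ r → level r ≤ level (suc r)
  level≤level-suc r = ≤-trans (level≤level+L r) (level+L≤level-suc r)

  E<level : ∀ r → E < level r
  E<level zero    = p<p+1 E
  E<level (suc r) = <-≤-trans (E<level r) (level≤level-suc r)

  -- The atoms outside R are known to hold at the top of the current window.
  Cover : List GAtom → Set
  Cover R = ∀ {x} → x ∈ Univ → Deriv x (level (suc (length R))) ⊎ x ∈ R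

  level-─ : ∀ {γ} (R : List GAtom) (γ∈R : γ ∈ R) → level (length R) ≡ level (suc (length (R ─ γ∈R)))
  level-─ R γ∈R = cong level (length-removeAt′ R (index γ∈R))

  Cover-─ : ∀ {γ s} (R : List GAtom) → Cover R → (γ∈R : γ ∈ R) → level (length R) ≤ s →
            Deriv γ s → Cover (R ─ γ∈R)
  Cover-─ R cover γ∈R level≤s dγ {x} x∈ with cover x∈
  ... | inj₁ dx = inj₁ (subst (Deriv x) (level-─ R γ∈R)
                          (Deriv-down (E<level (length R)) (level≤level-suc (length R)) dx))
  ... | inj₂ x∈R with ∈-─⁻ γ∈R x∈R
  ...   | inj₁ refl = inj₁ (subst (Deriv x) (level-─ R γ∈R) (Deriv-down (E<level (length R)) level≤s dγ))
  ...   | inj₂ x∈R′ = inj₂ x∈R′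

  mutual
    shift : ∀ n R → Cover R → ∀ {β t y} → level (length R) + L ≤ t → 0ℚ ≤ y → y ≤ fromℕ n →
            Deriv β t → Deriv β (t + y)
    shift n R cover {t = t} lo 0≤y y≤n (by-fact f∈ t∈) =
      by-fact f∈ (fact-beyond f∈ E<t (<-≤-trans E<t (p≤p+q t 0≤y)) t∈)
      where E<t = <-≤-trans (E<level (length R)) (≤-trans (level≤level+L (length R)) lo)
    shift n R cover lo 0≤y y≤n (by-plain σ r∈ ds) = by-plain σ r∈ (shiftAll n R cover lo 0≤y y≤n ds)
    shift n R cover {t = t} {y} lo 0≤y y≤n (by-diamond σ r∈ (s , 0≤t-s , t-s∈ , d)) with belowU-finite t-s∈
    ... | inj₁ refl = by-diamond σ r∈ (s , 0≤[t+y]-s , tt , d)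
      where
      0≤[t+y]-s : 0ℚ ≤ (t + y) - s
      0≤[t+y]-s = begin
        0ℚ             ≤⟨ 0≤t-s ⟩
        t - s          ≤⟨ p≤p+q (t - s) 0≤y ⟩
        (t - s) + y    ≡⟨ sym ([p+r]-q≡[p-q]+r t s y) ⟩
        (t + y) - s    ∎
    ... | inj₂ t-s≤u =
      by-diamond σ r∈ (s + y , subst (0ℚ ≤_) same-gap 0≤t-s , subst (belowU _) same-gap t-s∈ ,
                       shiftFrom n R cover (p+r≤t⇒t-s≤r⇒p≤s lo (≤-trans t-s≤u (reach≤L r∈))) 0≤y y≤n d)
      where same-gap = sym ([p+r]-[q+r]≡p-q t s y)

    shiftAll : ∀ n R → Cover R → ∀ {body σ t y} → level (length R) + L ≤ t → 0ℚ ≤ y → y ≤ fromℕ n →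
               All (λ b → Deriv (ground σ b) t) body → All (λ b → Deriv (ground σ b) (t + y)) body
    shiftAll n R cover lo 0≤y y≤n []       = []
    shiftAll n R cover lo 0≤y y≤n (d ∷ ds) = shift n R cover lo 0≤y y≤n d ∷ shiftAll n R cover lo 0≤y y≤n ds

    shiftFrom : ∀ n R → Cover R → ∀ {γ s y} → level (length R) ≤ s → 0ℚ ≤ y → y ≤ fromℕ n →
                Deriv γ s → Deriv γ (s + y)
    shiftFrom n R cover {s = s} level≤s 0≤y y≤n d with level (length R) + L ≤? s
    ... | yes above = shift n R cover above 0≤y y≤n d
    ... | no below with cover (Deriv⇒∈Univ d)
    ...   | inj₁ known =
      shiftKnown n R cover (≰⇒> below) (<-≤-trans (E<level (length R)) level≤s) 0≤y y≤n known
    ...   | inj₂ γ∈R   = shift n (R ─ γ∈R) (Cover-─ R cover γ∈R level≤s d) lo′ 0≤y y≤n d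
      where
      lo′ : level (length (R ─ γ∈R)) + L ≤ s
      lo′ = ≤-trans (level+L≤level-suc (length (R ─ γ∈R))) (subst (_≤ s) (level-─ R γ∈R) level≤s)

    shiftKnown : ∀ n R → Cover R → ∀ {γ s y} → s < level (length R) + L → E < s → 0ℚ ≤ y → y ≤ fromℕ n →
                 Deriv γ (level (suc (length R))) → Deriv γ (s + y)
    shiftKnown zero R cover {s = s} {y} s<top E<s 0≤y y≤0 known =
      Deriv-down (<-≤-trans E<s (p≤p+q s 0≤y)) s+y≤top known
      where
      s+y≤top : s + y ≤ level (suc (length R))
      s+y≤top = begin
        s + y                         ≤⟨ +-monoʳ-≤ s y≤0 ⟩
        s + 0ℚ                        ≡⟨ +-identityʳ s ⟩
        s                             ≤⟨ <⇒≤ s<top ⟩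
        level (length R) + L          ≤⟨ level+L≤level-suc (length R) ⟩
        level (suc (length R))        ∎
    shiftKnown (suc k) R cover {γ} {s} {y} s<top E<s 0≤y y≤n known with s + y ≤? level (suc (length R))
    ... | yes s+y≤top = Deriv-down (<-≤-trans E<s (p≤p+q s 0≤y)) s+y≤top known
    -- top ≥ s + 1, so the remaining shift (s + y) - top is at most y - 1.
    ... | no s+y≰top =
      subst (Deriv γ) (p+[q-p]≡q top (s + y))
        (shift k R cover (level+L≤level-suc (length R)) (p≤q⇒0≤q-p (<⇒≤ (≰⇒> s+y≰top)))
               (s≤p⇒[s+y]-[p+1]≤k (<⇒≤ s<top) (subst (y ≤_) (fromℕ-suc k) y≤n)) known)
      where top = level (suc (length R))

  T : ℚ
  T = level (length Univ) + L

  E<T : E < T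
  E<T = <-≤-trans (E<level (length Univ)) (level≤level+L (length Univ))

  Deriv-up : ∀ {α t} → T < t → Deriv α T → Deriv α t
  Deriv-up {α} {t} T<t d with archimedean (t - T)
  ... | n , t-T≤n =
    subst (Deriv α) (p+[q-p]≡q T t) (shift n Univ inj₂ ≤-refl (p≤q⇒0≤q-p (<⇒≤ T<t)) t-T≤n d)

corollary3 : (Π : Program) (D : Database) → SafeProgram Π →
    Σ ℚ (λ T → ∀ (t : ℚ) → T < t → ∀ (α : GAtom) →
      (α holdsAt t ∈⟦ Π , D ⟧) ⇔ (α holdsAt T ∈⟦ Π , D ⟧))
corollary3 Π D safe = T , λ t T<t α → mk⇔
  (Deriv-sound ∘ Deriv-down E<T (<⇒≤ T<t) ∘ Deriv-complete)
  (Deriv-sound ∘ Deriv-up T<t ∘ Deriv-complete)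
  where
  open Derivations Π D
  open Shifting Π D safe
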